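{- Let $\Delta$ be a C-Log theory over $\Sigma$. There exists an FO theory $S_\Delta$ over the $\Delta$-selection vocabulary $\mathrm{Sel}(\Sigma)$ such that for every set $D$ there is a one-to-one correspondence between selection functions for $\Delta$ in $D$ and models of $S_\Delta$ with domain $D$, where $\mathcal S$ corresponds to $\zeta^{in}$, $\mathrm{Choose1}_C$ to the set of tuples where the $\mathbf{Or}$-function of $C$ takes value $1$, $\mathrm{Sel}_C$ to the graph of the $\mathbf{Select}$-function of $C$, and $\mathrm{Create}_C$ to the graph of the $\mathbf{New}$-function of $C$.
   Context: Causal effect expressions (CEEs) over a relational vocabulary $\Sigma$ are built from atoms using $C'\leftarrow\varphi$, $C_1\ \mathbf{And}\ C_2$, $C_1\ \mathbf{Or}\ C_2$, $\mathbf{All}\,x[\varphi]:C'$, $\mathbf{Select}\,x[\varphi]:C'$ and $\mathbf{New}\,x:C'$ ($\varphi$ FO formulas); a C-Log theory is a CEE without free variables. The variable context of an occurrence $C$ of a sub-CEE in $\Delta$ is the sequence of variables quantified (by $\forall,\exists,\mathbf{All},\mathbf{Select},\mathbf{New}$) on the path from the root of the parse tree of $\Delta$ to $C$; $n_C$ is its length. A selection function $\zeta$ in a set $D$ consists of: for each occurrence $C$ of a $\mathbf{Select}$-expression, a total function $D^{n_C}\to D$; for each occurrence $C$ of an $\mathbf{Or}$-expression, a total function $D^{n_C}\to\{1,2\}$; for each occurrence $C$ of a $\mathbf{New}$-expression, an injective partial function $D^{n_C}\to D$; such that the images of all $\mathbf{New}$-functions are pairwise disjoint. The initial elements are $\zeta^{in}=D\setminus\bigcup_C\mathrm{image}$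 of the $\mathbf{New}$-functions. The $\Delta$-selection vocabulary $\mathrm{Sel}(\Sigma)$ consists of a unary predicate $\mathcal S$, an $n_C$-ary predicate $\mathrm{Choose1}_C$ for each occurrence $C$ of an $\mathbf{Or}$-expression, an $(n_C+1)$-ary predicate $\mathrm{Sel}_C$ for each occurrence of a $\mathbf{Select}$-expression, and an $(n_C+1)$-ary predicate $\mathrm{Create}_C$ for each occurrence of a $\mathbf{New}$-expression. -}

module Defs where

open import Data.Nat using (ℕ; zero; suc)
open import Data.Fin using (Fin)
open import Data.Vec using (Vec; []; _∷_; lookup; map; _∷ʳ_)
open import Data.Maybe using (Maybe; just; nothing)
open import Data.Product using (Σ; Σ-syntax; _×_; _,_; proj₁)
open import Data.Sum using (_⊎_)
open import Data.Empty using (⊥)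
open import Data.Unit using (⊤)
open import Relation.Binary.PropositionalEquality using (_≡_; _≢_)
open import Relation.Nullary using (¬_)
open import Function.Bundles using (_⇔_)

record Vocabulary : Set₁ where
  field
    Sym   : Set
    arity : Sym → ℕ
open Vocabulary public

-- Well-scoped de Bruijn syntax: `Formula V n` has n free variables
-- (variable 0 = most recently bound).

infix  7 _≐_
infixr 6 _∧′_
infixr 5 _∨′_
infixr 4 _⇒′_

data Formula (V : Vocabulary) (n : ℕ) : Set where
  atom   : (P : Sym V) → Vec (Fin n) (arity V P) → Formula V n
  _≐_    : Fin n → Fin n → Formula V n
  ⊤′ ⊥′  : Formula V n
  ¬′_    : Formula V n → Formula V n
  _∧′_ _∨′_ _⇒′_ : Formula V n → Formula V n → Formula V n
  ∀′ ∃′  : Formula V (suc n) → Formula V n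

Sentence : Vocabulary → Set
Sentence V = Formula V 0

FOTheory : Vocabulary → Set₁
FOTheory V = Sentence V → Set

record Structure (V : Vocabulary) (D : Set) : Set₁ where
  field
    rel : (P : Sym V) → Vec D (arity V P) → Set
open Structure public

_⊨_[_] : ∀ {V D n} → Structure V D → Formula V n → Vec D n → Set
M ⊨ atom P ts [ ρ ] = rel M P (map (lookup ρ) ts)
M ⊨ i ≐ j     [ ρ ] = lookup ρ i ≡ lookup ρ j
M ⊨ ⊤′        [ ρ ] = ⊤
M ⊨ ⊥′        [ ρ ] = ⊥
M ⊨ ¬′ φ      [ ρ ] = ¬ (M ⊨ φ [ ρ ])
M ⊨ φ ∧′ ψ    [ ρ ] = (M ⊨ φ [ ρ ]) × (M ⊨ ψ [ ρ ])
M ⊨ φ ∨′ ψ    [ ρ ] = (M ⊨ φ [ ρ ]) ⊎ (M ⊨ ψ [ ρ ])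
M ⊨ φ ⇒′ ψ    [ ρ ] = (M ⊨ φ [ ρ ]) → (M ⊨ ψ [ ρ ])
_⊨_[_] {D = D} M (∀′ φ) ρ = (d : D) → M ⊨ φ [ d ∷ ρ ]
_⊨_[_] {D = D} M (∃′ φ) ρ = Σ[ d ∈ D ] (M ⊨ φ [ d ∷ ρ ])

IsModel : ∀ {V D} → Structure V D → FOTheory V → Set
IsModel M T = ∀ φ → T φ → M ⊨ φ [ [] ]

-- Causal effect expressions (n = number of variables in scope)

infixl 3 _←_
infixr 2 _And_ _Or_

data CEE (V : Vocabulary) (n : ℕ) : Set where
  cAtom  : (P : Sym V) → Vec (Fin n) (arity V P) → CEE V n
  _←_    : CEE V n → Formula V n → CEE V n
  _And_  : CEE V n → CEE V n → CEE V n
  _Or_   : CEE V n → CEE V n → CEE V n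
  All    : Formula V (suc n) → CEE V (suc n) → CEE V n
  Select : Formula V (suc n) → CEE V (suc n) → CEE V n
  New    : CEE V (suc n) → CEE V n

CLogTheory : Vocabulary → Set
CLogTheory V = CEE V 0

-- Occurrences (positions in the parse tree) of sub-CEEs.
-- `Pos Δ C` : C occurs at this position; the index m of C : CEE V m is the
-- length n_C of the variable context of the occurrence (for Δ closed).
data Pos {V : Vocabulary} : {n m : ℕ} → CEE V n → CEE V m → Set where
  here     : ∀ {n} {C : CEE V n} → Pos C C
  in←      : ∀ {n m} {C : CEE V n} {φ} {E : CEE V m} → Pos C E → Pos (C ← φ) E
  inAndˡ   : ∀ {n m} {C₁ C₂ : CEE V n} {E : CEE V m} → Pos C₁ E → Pos (C₁ And C₂) E
  inAndʳ   : ∀ {n m} {C₁ C₂ : CEE V n} {E : CEE V m} → Pos C₂ E → Pos (C₁ And C₂) E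
  inOrˡ    : ∀ {n m} {C₁ C₂ : CEE V n} {E : CEE V m} → Pos C₁ E → Pos (C₁ Or C₂) E
  inOrʳ    : ∀ {n m} {C₁ C₂ : CEE V n} {E : CEE V m} → Pos C₂ E → Pos (C₁ Or C₂) E
  inAll    : ∀ {n m} {φ : Formula V (suc n)} {C : CEE V (suc n)} {E : CEE V m} →
             Pos C E → Pos (All φ C) E
  inSelect : ∀ {n m} {φ : Formula V (suc n)} {C : CEE V (suc n)} {E : CEE V m} →
             Pos C E → Pos (Select φ C) E
  inNew    : ∀ {n m} {C : CEE V (suc n)} {E : CEE V m} → Pos C E → Pos (New C) E

module _ {V : Vocabulary} (Δ : CLogTheory V) where

  -- occurrences of Or-, Select- and New-expressions; first component = n_C
  OrOcc : Set
  OrOcc = Σ[ m ∈ ℕ ] Σ[ C₁ ∈ CEE V m ] Σ[ C₂ ∈ CEE V m ] Pos Δ (C₁ Or C₂)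

  SelectOcc : Set
  SelectOcc = Σ[ m ∈ ℕ ] Σ[ φ ∈ Formula V (suc m) ] Σ[ C ∈ CEE V (suc m) ] Pos Δ (Select φ C)

  NewOcc : Set
  NewOcc = Σ[ m ∈ ℕ ] Σ[ C ∈ CEE V (suc m) ] Pos Δ (New C)

  data SelSym : Set where
    𝒮       : SelSym
    Choose1 : OrOcc → SelSym
    SelC    : SelectOcc → SelSym
    Create  : NewOcc → SelSym

  selArity : SelSym → ℕ
  selArity 𝒮           = 1
  selArity (Choose1 o) = proj₁ o
  selArity (SelC o)    = suc (proj₁ o)
  selArity (Create o)  = suc (proj₁ o)

  SelVocab : Vocabulary
  SelVocab = record { Sym = SelSym ; arity = selArity }

  data OneTwo : Set where
    one two : OneTwo

  record SelFun (D : Set) : Set where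
    field
      orF  : (o : OrOcc) → Vec D (proj₁ o) → OneTwo
      selF : (o : SelectOcc) → Vec D (proj₁ o) → D
      newF : (o : NewOcc) → Vec D (proj₁ o) → Maybe D
      newF-injective : ∀ o (xs ys : Vec D (proj₁ o)) (y : D) →
                       newF o xs ≡ just y → newF o ys ≡ just y → xs ≡ ys
      newF-disjoint  : ∀ o o' → o ≢ o' → ∀ (xs : Vec D (proj₁ o)) (ys : Vec D (proj₁ o')) (y : D) →
                       newF o xs ≡ just y → newF o' ys ≡ just y → ⊥
  open SelFun public

  ζin : ∀ {D} → SelFun D → D → Set
  ζin ζ d = ¬ (Σ[ o ∈ NewOcc ] Σ[ xs ∈ Vec _ (proj₁ o) ] newF ζ o xs ≡ just d)

  record Corresponds {D : Set} (ζ : SelFun D) (M : Structure SelVocab D) : Set where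
    field
      S↔ζin      : ∀ d → rel M 𝒮 (d ∷ []) ⇔ ζin ζ d
      Choose1↔   : ∀ o xs → rel M (Choose1 o) xs ⇔ (orF ζ o xs ≡ one)
      Sel↔graph  : ∀ o xs y → rel M (SelC o) (xs ∷ʳ y) ⇔ (selF ζ o xs ≡ y)
      Create↔graph : ∀ o xs y → rel M (Create o) (xs ∷ʳ y) ⇔ (newF ζ o xs ≡ just y)

  SameSelFun : ∀ {D} → SelFun D → SelFun D → Set
  SameSelFun ζ ζ' = (∀ o xs → orF ζ o xs ≡ orF ζ' o xs)
                  × (∀ o xs → selF ζ o xs ≡ selF ζ' o xs)
                  × (∀ o xs → newF ζ o xs ≡ newF ζ' o xs)

  SameStructure : ∀ {D} → Structure SelVocab D → Structure SelVocab D → Set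
  SameStructure M M' = ∀ P xs → rel M P xs ⇔ rel M' P xs

  OneToOneCorrespondence : FOTheory SelVocab → Set₁
  OneToOneCorrespondence T = (D : Set) →
      ((ζ : SelFun D) → Σ[ M ∈ Structure SelVocab D ] (IsModel M T × Corresponds ζ M))
    × ((M : Structure SelVocab D) → IsModel M T → Σ[ ζ ∈ SelFun D ] Corresponds ζ M)
    × (∀ (ζ ζ' : SelFun D) (M : Structure SelVocab D) →
         Corresponds ζ M → Corresponds ζ' M → SameSelFun ζ ζ')
    × (∀ (ζ : SelFun D) (M M' : Structure SelVocab D) →
         Corresponds ζ M → Corresponds ζ M' → SameStructure M M')

-- A selection function consists of finitely many total functions Dⁿ → D, functions Dⁿ → {1,2}
-- and injective partial functions Dⁿ ⇀ D with pairwise disjoint images, and each of them is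
-- determined by its graph.  S_Δ says that every Sel_C is the graph of a total function, that
-- every Create_C is the graph of an injective partial function, that the Create_C have pairwise
-- disjoint images, and that 𝒮 is the complement of the union of these images; the union is a
-- finite disjunction because Δ has only finitely many New-occurrences.  The models of S_Δ are
-- then exactly the structures built from the graphs of a selection function, and graphs
-- determine functions.
-- Constructively, reading the Or-functions and the domains of the New-functions off a model
-- needs Choose1_C and the domain of Create_C to be decidable, so S_Δ also contains these
-- instances of excluded middle.  They are classically valid, so S_Δ is classically equivalent
-- to the theory of the paper.
module Submission where

open import Defs
open import Data.Nat using (ℕ; zero; suc; _+_)
open import Data.Fin using (Fin; zero; suc; _↑ˡ_; _↑ʳ_)
open import Data.Vec using (Vec; []; _∷_; _∷ʳ_; _++_; lookup; map; tabulate; head; init; last; initLast)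
open import Data.Vec.Properties
  using ( ∷-injective; init-∷ʳ; last-∷ʳ; map-∷ʳ; map-∘; map-cong
        ; tabulate-∘; tabulate-cong; tabulate∘lookup; lookup-++ˡ; lookup-++ʳ )
open import Data.List using (List; []; _∷_)
import Data.List as List
open import Data.List.Membership.Propositional using (_∈_; lose)
open import Data.List.Membership.Propositional.Properties using (∈-map⁺; ∈-++⁺ˡ; ∈-++⁺ʳ)
open import Data.List.Relation.Unary.Any using (Any; here; there; satisfied)
open import Data.List.Relation.Unary.Enumerates.Setoid using (IsEnumeration)
open import Data.Product using (Σ-syntax; _,_; proj₁; proj₂)
open import Data.Sum using (_⊎_; inj₁; inj₂)
open import Data.Sum.Function.Propositional using (_⊎-⇔_)
open import Data.Empty using (⊥; ⊥-elim)
open import Data.Maybe using (Maybe; just; nothing)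
open import Data.Maybe.Properties using (just-injective)
open import Relation.Binary.PropositionalEquality
  using (_≡_; _≢_; refl; sym; trans; cong; cong₂; subst; subst₂; setoid; module ≡-Reasoning)
open import Relation.Nullary using (¬_; Dec; yes; no)
open import Relation.Nullary.Decidable using (fromSum; toSum)
import Relation.Nullary.Decidable as Dec
open import Relation.Unary using (Decidable)
open import Function using (_∘_)
open import Function.Bundles using (_⇔_; mk⇔; Equivalence)
open import Function.Construct.Identity using (⇔-id)
open import Function.Construct.Symmetry using (⇔-sym)
open import Function.Construct.Composition using (_⇔-∘_)
open import Function.Related.TypeIsomorphisms using (¬-cong-⇔)

open Equivalence using (to; from)

private
  variable
    D : Set
    j k m n : ℕ

-- Relations R ⊆ Dᵐ⁺¹ viewed as graphs of (partial) functions Dᵐ ⇀ D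

module _ (R : Vec D (suc m) → Set) where

  Domain : Vec D m → Set
  Domain xs = Σ[ y ∈ D ] R (xs ∷ʳ y)

  Image : D → Set
  Image y = Σ[ xs ∈ Vec D m ] R (xs ∷ʳ y)

  IsTotal : Set
  IsTotal = ∀ xs → Domain xs

  IsFunctional : Set
  IsFunctional = ∀ {xs y y′} → R (xs ∷ʳ y) → R (xs ∷ʳ y′) → y ≡ y′

  IsInjective : Set
  IsInjective = ∀ {xs xs′ y} → R (xs ∷ʳ y) → R (xs′ ∷ʳ y) → xs ≡ xs′

AreDisjoint : {m m′ : ℕ} → (Vec D (suc m) → Set) → (Vec D (suc m′) → Set) → Set
AreDisjoint R R′ = ∀ {y} → Image R y → Image R′ y → ⊥

partial : {R : Vec D (suc m) → Set} → Decidable (Domain R) → Vec D m → Maybe D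
partial dom? xs with dom? xs
... | yes (y , _) = just y
... | no _        = nothing

module _ {R : Vec D (suc m) → Set} (R-functional : IsFunctional R) where

  total-graph : (total : IsTotal R) (xs : Vec D m) (y : D) → proj₁ (total xs) ≡ y ⇔ R (xs ∷ʳ y)
  total-graph total xs y = mk⇔ (λ { refl → proj₂ (total xs) }) (R-functional (proj₂ (total xs)))

  partial-graph : (dom? : Decidable (Domain R)) (xs : Vec D m) (y : D) →
                  partial {R = R} dom? xs ≡ just y ⇔ R (xs ∷ʳ y)
  partial-graph dom? xs y with dom? xs
  ... | yes (y′ , r′) = mk⇔ (λ { refl → r′ }) (cong just ∘ R-functional r′)
  ... | no ¬dom       = mk⇔ (λ ()) (λ r → ⊥-elim (¬dom (y , r)))

uncurryʳ : (Vec D m → D → Set) → Vec D (suc m) → Set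
uncurryʳ G v = G (init v) (last v)

uncurryʳ-∷ʳ : (G : Vec D m → D → Set) (xs : Vec D m) (y : D) → uncurryʳ G (xs ∷ʳ y) ⇔ G xs y
uncurryʳ-∷ʳ G xs y rewrite init-∷ʳ y xs | last-∷ʳ y xs = ⇔-id _

⇔-uncurryʳ : {R : Vec D (suc m) → Set} (G : Vec D m → D → Set) →
             (∀ xs y → R (xs ∷ʳ y) ⇔ G xs y) → ∀ v → R v ⇔ uncurryʳ G v
⇔-uncurryʳ {R = R} G R⇔G v =
  let (xs , y , v≡xs∷ʳy) = initLast v
  in subst (λ v → R v ⇔ uncurryʳ G v) (sym v≡xs∷ʳy) (⇔-sym (uncurryʳ-∷ʳ G xs y) ⇔-∘ R⇔G xs y)

just? : (a : Maybe D) → Dec (Σ[ y ∈ D ] a ≡ just y)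
just? (just y) = yes (y , refl)
just? nothing  = no λ { (_ , ()) }

≡-by-just : {a b : Maybe D} → (∀ y → a ≡ just y ⇔ b ≡ just y) → a ≡ b
≡-by-just {a = just y}            a⇔b = sym (to (a⇔b y) refl)
≡-by-just {a = nothing} {just y}  a⇔b = from (a⇔b y) refl
≡-by-just {a = nothing} {nothing} _   = refl

-- First-order sentence schemes and their meaning

module FirstOrder {V : Vocabulary} where

  ⟦_⟧_ : Vec (Fin k) m → Vec D k → Vec D m
  ⟦ ts ⟧ ρ = map (lookup ρ) ts

  vars : ∀ m {n} → Vec (Fin (m + n)) m
  vars m {n} = tabulate (_↑ˡ n)

  ⟦vars⟧ : (xs : Vec D m) (ρ : Vec D n) → ⟦ vars m ⟧ (xs ++ ρ) ≡ xs
  ⟦vars⟧ {n = n} xs ρ = begin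
    map (lookup (xs ++ ρ)) (tabulate (_↑ˡ n)) ≡⟨ tabulate-∘ (lookup (xs ++ ρ)) (_↑ˡ n) ⟨
    tabulate (lookup (xs ++ ρ) ∘ (_↑ˡ n))     ≡⟨ tabulate-cong (lookup-++ˡ xs ρ) ⟩
    tabulate (lookup xs)                      ≡⟨ tabulate∘lookup xs ⟩
    xs                                        ∎
    where open ≡-Reasoning

  ⟦↑ʳ⟧ : (xs : Vec D m) (ρ : Vec D n) (ts : Vec (Fin n) k) → ⟦ map (m ↑ʳ_) ts ⟧ (xs ++ ρ) ≡ ⟦ ts ⟧ ρ
  ⟦↑ʳ⟧ {m = m} xs ρ ts = trans (sym (map-∘ (lookup (xs ++ ρ)) (m ↑ʳ_) ts)) (map-cong (lookup-++ʳ xs ρ) ts)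

  vars∷ʳ : ∀ m {n} → Fin n → Vec (Fin (m + n)) (suc m)
  vars∷ʳ m i = vars m ∷ʳ (m ↑ʳ i)

  ⟦vars∷ʳ⟧ : (xs : Vec D m) (ρ : Vec D n) (i : Fin n) → ⟦ vars∷ʳ m i ⟧ (xs ++ ρ) ≡ xs ∷ʳ lookup ρ i
  ⟦vars∷ʳ⟧ {m = m} xs ρ i = begin
    ⟦ vars m ∷ʳ (m ↑ʳ i) ⟧ (xs ++ ρ)                  ≡⟨ map-∷ʳ (lookup (xs ++ ρ)) (m ↑ʳ i) (vars m) ⟩
    ⟦ vars m ⟧ (xs ++ ρ) ∷ʳ lookup (xs ++ ρ) (m ↑ʳ i) ≡⟨ cong₂ _∷ʳ_ (⟦vars⟧ xs ρ) (lookup-++ʳ xs ρ i) ⟩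
    xs ∷ʳ lookup ρ i                                  ∎
    where open ≡-Reasoning

  -- ts, read under j further binders, followed by the i-th of these binders
  _⊲_ : Vec (Fin n) m → Fin j → Vec (Fin (j + n)) (suc m)
  _⊲_ {j = j} ts i = map (j ↑ʳ_) ts ∷ʳ (i ↑ˡ _)

  ⟦⊲⟧ : (zs : Vec D j) (ρ : Vec D n) (ts : Vec (Fin n) m) (i : Fin j) →
        ⟦ ts ⊲ i ⟧ (zs ++ ρ) ≡ ⟦ ts ⟧ ρ ∷ʳ lookup zs i
  ⟦⊲⟧ {j = j} zs ρ ts i = begin
    ⟦ map (j ↑ʳ_) ts ∷ʳ (i ↑ˡ _) ⟧ (zs ++ ρ)
      ≡⟨ map-∷ʳ (lookup (zs ++ ρ)) (i ↑ˡ _) (map (j ↑ʳ_) ts) ⟩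
    ⟦ map (j ↑ʳ_) ts ⟧ (zs ++ ρ) ∷ʳ lookup (zs ++ ρ) (i ↑ˡ _)
      ≡⟨ cong₂ _∷ʳ_ (⟦↑ʳ⟧ zs ρ ts) (lookup-++ˡ zs ρ i) ⟩
    ⟦ ts ⟧ ρ ∷ʳ lookup zs i
      ∎
    where open ≡-Reasoning

  ∀ⁿ ∃ⁿ : ∀ m {n} → Formula V (m + n) → Formula V n
  ∀ⁿ zero    φ = φ
  ∀ⁿ (suc m) φ = ∀ⁿ m (∀′ φ)
  ∃ⁿ zero    φ = φ
  ∃ⁿ (suc m) φ = ∃ⁿ m (∃′ φ)

  ⋁ : {X : Set} → List X → (X → Formula V k) → Formula V k
  ⋁ []       φ = ⊥′
  ⋁ (x ∷ xs) φ = φ x ∨′ ⋁ xs φ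

  infix 7 _≐ⱽ_
  _≐ⱽ_ : Vec (Fin k) m → Vec (Fin k) m → Formula V k
  []       ≐ⱽ []       = ⊤′
  (t ∷ ts) ≐ⱽ (u ∷ us) = (t ≐ u) ∧′ (ts ≐ⱽ us)

  infix 4 _⇔′_
  _⇔′_ : Formula V k → Formula V k → Formula V k
  φ ⇔′ ψ = (φ ⇒′ ψ) ∧′ (ψ ⇒′ φ)

  module _ (M : Structure V D) where

    ⊨∀ⁿ : ∀ m (φ : Formula V (m + n)) (ρ : Vec D n) →
          M ⊨ ∀ⁿ m φ [ ρ ] ⇔ (∀ xs → M ⊨ φ [ xs ++ ρ ])
    ⊨∀ⁿ zero    φ ρ = mk⇔ (λ h → λ { [] → h }) (λ h → h [])
    ⊨∀ⁿ (suc m) φ ρ = mk⇔ (λ h → λ { (x ∷ xs) → to (⊨∀ⁿ m (∀′ φ) ρ) h xs x })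
                          (λ h → from (⊨∀ⁿ m (∀′ φ) ρ) (λ xs x → h (x ∷ xs)))

    ⊨∃ⁿ : ∀ m (φ : Formula V (m + n)) (ρ : Vec D n) →
          M ⊨ ∃ⁿ m φ [ ρ ] ⇔ (Σ[ xs ∈ Vec D m ] M ⊨ φ [ xs ++ ρ ])
    ⊨∃ⁿ zero    φ ρ = mk⇔ ([] ,_) (λ { ([] , h) → h })
    ⊨∃ⁿ (suc m) φ ρ = mk⇔ (λ h → let (xs , x , h′) = to (⊨∃ⁿ m (∃′ φ) ρ) h in x ∷ xs , h′)
                          (λ { (x ∷ xs , h) → from (⊨∃ⁿ m (∃′ φ) ρ) (xs , x , h) })

    ⊨⋁ : {X : Set} {xs : List X} → IsEnumeration (setoid X) xs →
         (φ : X → Formula V k) (ρ : Vec D k) {P : X → Set} → (∀ x → M ⊨ φ x [ ρ ] ⇔ P x) →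
         M ⊨ ⋁ xs φ [ ρ ] ⇔ (Σ[ x ∈ X ] P x)
    ⊨⋁ {xs = xs} enum φ ρ φ⇔P =
      mk⇔ (λ h → let (x , h′) = satisfied (to (⊨⋁-Any xs) h) in x , to (φ⇔P x) h′)
          (λ (x , p) → from (⊨⋁-Any xs) (lose (enum x) (from (φ⇔P x) p)))
      where
      ⊨⋁-Any : ∀ xs → M ⊨ ⋁ xs φ [ ρ ] ⇔ Any (λ x → M ⊨ φ x [ ρ ]) xs
      ⊨⋁-Any []       = mk⇔ (λ ()) (λ ())
      ⊨⋁-Any (x ∷ xs) = mk⇔ (λ { (inj₁ h) → here h ; (inj₂ h) → there (to (⊨⋁-Any xs) h) })
                            (λ { (here h) → inj₁ h ; (there h) → inj₂ (from (⊨⋁-Any xs) h) })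

    ⊨≐ⱽ : (ts us : Vec (Fin k) m) (ρ : Vec D k) → M ⊨ ts ≐ⱽ us [ ρ ] ⇔ ⟦ ts ⟧ ρ ≡ ⟦ us ⟧ ρ
    ⊨≐ⱽ []       []       ρ = mk⇔ (λ _ → refl) _
    ⊨≐ⱽ (t ∷ ts) (u ∷ us) ρ =
      mk⇔ (λ (e , es) → cong₂ _∷_ e (to (⊨≐ⱽ ts us ρ) es))
          (λ e → let (e₁ , e₂) = ∷-injective e in e₁ , from (⊨≐ⱽ ts us ρ) e₂)

    ⊨⇔′ : (φ ψ : Formula V k) {ρ : Vec D k} {P Q : Set} →
          M ⊨ φ [ ρ ] ⇔ P → M ⊨ ψ [ ρ ] ⇔ Q → M ⊨ φ ⇔′ ψ [ ρ ] ⇔ (P ⇔ Q)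
    ⊨⇔′ φ ψ φ⇔P ψ⇔Q =
      mk⇔ (λ (φ⇒ψ , ψ⇒φ) → mk⇔ (to ψ⇔Q ∘ φ⇒ψ ∘ from φ⇔P) (to φ⇔P ∘ ψ⇒φ ∘ from ψ⇔Q))
          (λ P⇔Q → from ψ⇔Q ∘ to P⇔Q ∘ to φ⇔P , from φ⇔P ∘ from P⇔Q ∘ to ψ⇔Q)

  -- formulas with m argument places, uniformly in the context; atom P is the basic example
  Former : ℕ → Set
  Former m = ∀ {k} → Vec (Fin k) m → Formula V k

  record Expresses (M : Structure V D) (A : Former m) (R : Vec D m → Set) : Set where
    constructor mkExpresses
    field
      expresses : ∀ {k} (ts : Vec (Fin k) m) ρ → M ⊨ A ts [ ρ ] ⇔ R (⟦ ts ⟧ ρ)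

    expresses-at : {ts : Vec (Fin k) m} {ρ : Vec D k} {xs : Vec D m} → ⟦ ts ⟧ ρ ≡ xs → M ⊨ A ts [ ρ ] ⇔ R xs
    expresses-at {ts = ts} {ρ} refl = expresses ts ρ

    expresses-at-vars : ∀ xs → M ⊨ A (vars m) [ xs ++ [] ] ⇔ R xs
    expresses-at-vars xs = expresses-at (⟦vars⟧ xs [])

  open Expresses

  atom-expresses : (M : Structure V D) (P : Sym V) → Expresses M (atom P) (rel M P)
  atom-expresses M P = mkExpresses (λ ts ρ → ⇔-id _)

  Domain′ : Former (suc m) → Former m
  Domain′ A ts = ∃′ (A (ts ⊲ zero))

  Image′ : Former (suc m) → Former 1
  Image′ {m} A (t ∷ []) = ∃ⁿ m (A (vars∷ʳ m t))

  module _ {M : Structure V D} {A : Former (suc m)} {R : Vec D (suc m) → Set} (A⇔R : Expresses M A R) where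

    expresses-at-⊲ : {ts : Vec (Fin n) m} {ρ : Vec D n} {xs : Vec D m} → ⟦ ts ⟧ ρ ≡ xs →
                     (zs : Vec D j) (i : Fin j) → M ⊨ A (ts ⊲ i) [ zs ++ ρ ] ⇔ R (xs ∷ʳ lookup zs i)
    expresses-at-⊲ {ts = ts} {ρ} refl zs i = expresses-at A⇔R (⟦⊲⟧ zs ρ ts i)

    Domain′-expresses : Expresses M (Domain′ A) (Domain R)
    Domain′-expresses = mkExpresses λ ts ρ →
      mk⇔ (λ (y , a) → y , to   (expresses-at-⊲ refl (y ∷ []) zero) a)
          (λ (y , r) → y , from (expresses-at-⊲ refl (y ∷ []) zero) r)

    Image′-expresses : Expresses M (Image′ A) (Image R ∘ head)
    Image′-expresses = mkExpresses λ { (t ∷ []) ρ →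
      mk⇔ (λ h → let (xs , a) = to (⊨∃ⁿ M m _ ρ) h in xs , to (expresses-at A⇔R (⟦vars∷ʳ⟧ xs ρ t)) a)
          (λ (xs , r) → from (⊨∃ⁿ M m _ ρ) (xs , from (expresses-at A⇔R (⟦vars∷ʳ⟧ xs ρ t)) r)) }

    Image′-at : ∀ y → M ⊨ Image′ A (zero ∷ []) [ y ∷ [] ] ⇔ Image R y
    Image′-at y = expresses Image′-expresses (zero ∷ []) (y ∷ [])

  decidable′ : Former m → Sentence V
  decidable′ {m} A = ∀ⁿ m (A (vars m) ∨′ ¬′ A (vars m))

  total′ : Former (suc m) → Sentence V
  total′ {m} A = ∀ⁿ m (Domain′ A (vars m))

  functional′ : Former (suc m) → Sentence V
  functional′ {m} A = ∀ⁿ m (∀′ (∀′ (A (vars m ⊲ y) ⇒′ A (vars m ⊲ y′) ⇒′ (y ↑ˡ _) ≐ (y′ ↑ˡ _))))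
    where
    y y′ : Fin 2
    y  = suc zero
    y′ = zero

  injective′ : Former (suc m) → Sentence V
  injective′ {m} A = ∀ⁿ m (∀ⁿ m (∃′ (A (xs ⊲ y) ∧′ A (xs′ ⊲ y)) ⇒′ xs ≐ⱽ xs′))
    where
    y : Fin 1
    y = zero
    xs xs′ : Vec (Fin (m + (m + 0))) m
    xs  = map (m ↑ʳ_) (vars m)
    xs′ = vars m

  disjoint′ : {m m′ : ℕ} → Former (suc m) → Former (suc m′) → Sentence V
  disjoint′ A B = ∀′ (¬′ (Image′ A (zero ∷ []) ∧′ Image′ B (zero ∷ [])))

  complement′ : {X : Set} {arity : X → ℕ} →
                Former 1 → List X → ((x : X) → Former (suc (arity x))) → Sentence V
  complement′ S xs A = ∀′ (S (zero ∷ []) ⇔′ ¬′ ⋁ xs (λ x → Image′ (A x) (zero ∷ [])))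

  module _ {M : Structure V D} {A : Former m} {R : Vec D m → Set} (A⇔R : Expresses M A R) where

    ⊨decidable′ : M ⊨ decidable′ A [ [] ] ⇔ Decidable R
    ⊨decidable′ = mk⇔ (λ h xs → fromSum (to (excluded-middle xs) (to (⊨∀ⁿ M m _ []) h xs)))
                      (λ R? → from (⊨∀ⁿ M m _ []) (λ xs → from (excluded-middle xs) (toSum (R? xs))))
      where
      excluded-middle : ∀ xs → M ⊨ A (vars m) ∨′ ¬′ A (vars m) [ xs ++ [] ] ⇔ (R xs ⊎ ¬ R xs)
      excluded-middle xs = expresses-at-vars A⇔R xs ⊎-⇔ ¬-cong-⇔ (expresses-at-vars A⇔R xs)

  module _ {M : Structure V D} {A : Former (suc m)} {R : Vec D (suc m) → Set} (A⇔R : Expresses M A R) where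

    ⊨total′ : M ⊨ total′ A [ [] ] ⇔ IsTotal R
    ⊨total′ = mk⇔ (λ h xs → to (domain xs) (to (⊨∀ⁿ M m _ []) h xs))
                  (λ total → from (⊨∀ⁿ M m _ []) (λ xs → from (domain xs) (total xs)))
      where
      domain : ∀ xs → M ⊨ Domain′ A (vars m) [ xs ++ [] ] ⇔ Domain R xs
      domain = expresses-at-vars (Domain′-expresses A⇔R)

    ⊨functional′ : M ⊨ functional′ A [ [] ] ⇔ IsFunctional R
    ⊨functional′ =
      mk⇔ (λ h {xs} {y} {y′} r r′ →
             to (⊨∀ⁿ M m _ []) h xs y y′ (from (A-at xs y y′ (suc zero)) r) (from (A-at xs y y′ zero) r′))
          (λ R-functional → from (⊨∀ⁿ M m _ []) λ xs y y′ a a′ →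
             R-functional (to (A-at xs y y′ (suc zero)) a) (to (A-at xs y y′ zero) a′))
      where
      A-at : ∀ xs y y′ i → M ⊨ A (vars m ⊲ i) [ y′ ∷ y ∷ (xs ++ []) ] ⇔ R (xs ∷ʳ lookup (y′ ∷ y ∷ []) i)
      A-at xs y y′ = expresses-at-⊲ A⇔R (⟦vars⟧ xs []) (y′ ∷ y ∷ [])

    ⊨injective′ : M ⊨ injective′ A [ [] ] ⇔ IsInjective R
    ⊨injective′ =
      mk⇔ (λ h {xs} {xs′} {y} r r′ →
             to (equal xs xs′) (to (⊨∀ⁿ M m _ (xs ++ [])) (to (⊨∀ⁿ M m _ []) h xs) xs′
                                   (y , from (A-at-xs xs xs′) r , from (A-at-xs′ xs xs′) r′)))
          (λ R-injective → from (⊨∀ⁿ M m _ []) λ xs → from (⊨∀ⁿ M m _ (xs ++ [])) λ xs′ (_ , a , a′) →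
             from (equal xs xs′) (R-injective (to (A-at-xs xs xs′) a) (to (A-at-xs′ xs xs′) a′)))
      where
      ⟦xs⟧ : ∀ xs xs′ → ⟦ map (m ↑ʳ_) (vars m) ⟧ (xs′ ++ (xs ++ [])) ≡ xs
      ⟦xs⟧ xs xs′ = trans (⟦↑ʳ⟧ xs′ (xs ++ []) (vars m)) (⟦vars⟧ xs [])

      equal : ∀ xs xs′ → M ⊨ map (m ↑ʳ_) (vars m) ≐ⱽ vars m [ xs′ ++ (xs ++ []) ] ⇔ xs ≡ xs′
      equal xs xs′ = subst₂ (λ v w → M ⊨ map (m ↑ʳ_) (vars m) ≐ⱽ vars m [ xs′ ++ (xs ++ []) ] ⇔ v ≡ w)
                            (⟦xs⟧ xs xs′) (⟦vars⟧ xs′ (xs ++ [])) (⊨≐ⱽ M _ _ _)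

      A-at-xs : ∀ xs xs′ {y} → M ⊨ A (map (m ↑ʳ_) (vars m) ⊲ zero) [ y ∷ (xs′ ++ (xs ++ [])) ] ⇔ R (xs ∷ʳ y)
      A-at-xs xs xs′ {y} = expresses-at-⊲ A⇔R (⟦xs⟧ xs xs′) (y ∷ []) zero

      A-at-xs′ : ∀ xs xs′ {y} → M ⊨ A (vars m ⊲ zero) [ y ∷ (xs′ ++ (xs ++ [])) ] ⇔ R (xs′ ∷ʳ y)
      A-at-xs′ xs xs′ {y} = expresses-at-⊲ A⇔R (⟦vars⟧ xs′ (xs ++ [])) (y ∷ []) zero

  module _ {M : Structure V D} {m m′ : ℕ} {A : Former (suc m)} {B : Former (suc m′)}
           {R : Vec D (suc m) → Set} {R′ : Vec D (suc m′) → Set}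
           (A⇔R : Expresses M A R) (B⇔R′ : Expresses M B R′) where

    ⊨disjoint′ : M ⊨ disjoint′ A B [ [] ] ⇔ AreDisjoint R R′
    ⊨disjoint′ = mk⇔ (λ h {y} im im′ → h y (from (Image′-at A⇔R y) im , from (Image′-at B⇔R′ y) im′))
                     (λ R#R′ y (a , b) → R#R′ (to (Image′-at A⇔R y) a) (to (Image′-at B⇔R′ y) b))

  module _ {M : Structure V D} {X : Set} {arity : X → ℕ} {xs : List X} (enum : IsEnumeration (setoid X) xs)
           {S : Former 1} {Sᴿ : Vec D 1 → Set} (S⇔Sᴿ : Expresses M S Sᴿ)
           {A : (x : X) → Former (suc (arity x))} {R : (x : X) → Vec D (suc (arity x)) → Set}
           (A⇔R : ∀ x → Expresses M (A x) (R x)) where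

    ⊨complement′ : M ⊨ complement′ S xs A [ [] ] ⇔ (∀ y → Sᴿ (y ∷ []) ⇔ (¬ (Σ[ x ∈ X ] Image (R x) y)))
    ⊨complement′ = mk⇔ (λ h y → to (instance-at y) (h y)) (λ S≡∁ y → from (instance-at y) (S≡∁ y))
      where
      image : X → Formula V 1
      image x = Image′ (A x) (zero ∷ [])

      instance-at : ∀ y → M ⊨ S (zero ∷ []) ⇔′ ¬′ ⋁ xs image [ y ∷ [] ] ⇔
                          (Sᴿ (y ∷ []) ⇔ (¬ (Σ[ x ∈ X ] Image (R x) y)))
      instance-at y = ⊨⇔′ M (S (zero ∷ [])) (¬′ ⋁ xs image) (expresses S⇔Sᴿ (zero ∷ []) (y ∷ []))
                            (¬-cong-⇔ (⊨⋁ M enum image (y ∷ []) (λ x → Image′-at (A⇔R x) y)))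

module _ {V : Vocabulary} where

  NewOccIn : CEE V n → Set
  NewOccIn C = Σ[ m ∈ ℕ ] Σ[ C′ ∈ CEE V (suc m) ] Pos C (New C′)

  private
    inside : {C₀ : CEE V k} {C : CEE V n} →
             (∀ {j} {E : CEE V j} → Pos C₀ E → Pos C E) → NewOccIn C₀ → NewOccIn C
    inside f (m , C′ , p) = m , C′ , f p

  newOccs : (C : CEE V n) → List (NewOccIn C)
  newOccs (cAtom P ts) = []
  newOccs (C ← φ)      = List.map (inside in←) (newOccs C)
  newOccs (C₁ And C₂)  = List.map (inside inAndˡ) (newOccs C₁) List.++ List.map (inside inAndʳ) (newOccs C₂)
  newOccs (C₁ Or C₂)   = List.map (inside inOrˡ) (newOccs C₁) List.++ List.map (inside inOrʳ) (newOccs C₂)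
  newOccs (All φ C)    = List.map (inside inAll) (newOccs C)
  newOccs (Select φ C) = List.map (inside inSelect) (newOccs C)
  newOccs (New C)      = (_ , C , here) ∷ List.map (inside inNew) (newOccs C)

  ∈-newOccs : {C : CEE V n} {C′ : CEE V (suc m)} (p : Pos C (New C′)) → (m , C′ , p) ∈ newOccs C
  ∈-newOccs here         = here refl
  ∈-newOccs (in← p)      = ∈-map⁺ (inside in←) (∈-newOccs p)
  ∈-newOccs (inAndˡ p)   = ∈-++⁺ˡ (∈-map⁺ (inside inAndˡ) (∈-newOccs p))
  ∈-newOccs {C = C₁ And _} (inAndʳ p) =
    ∈-++⁺ʳ (List.map (inside inAndˡ) (newOccs C₁)) (∈-map⁺ (inside inAndʳ) (∈-newOccs p))
  ∈-newOccs (inOrˡ p)    = ∈-++⁺ˡ (∈-map⁺ (inside inOrˡ) (∈-newOccs p))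
  ∈-newOccs {C = C₁ Or _} (inOrʳ p) =
    ∈-++⁺ʳ (List.map (inside inOrˡ) (newOccs C₁)) (∈-map⁺ (inside inOrʳ) (∈-newOccs p))
  ∈-newOccs (inAll p)    = ∈-map⁺ (inside inAll) (∈-newOccs p)
  ∈-newOccs (inSelect p) = ∈-map⁺ (inside inSelect) (∈-newOccs p)
  ∈-newOccs (inNew p)    = there (∈-map⁺ (inside inNew) (∈-newOccs p))

  newOccs-enumerates : (C : CEE V n) → IsEnumeration (setoid (NewOccIn C)) (newOccs C)
  newOccs-enumerates C (m , C′ , p) = ∈-newOccs p

-- The theory S_Δ

module SelectionTheory {V : Vocabulary} (Δ : CLogTheory V) where

  open FirstOrder {SelVocab Δ}

  data SΔ : Sentence (SelVocab Δ) → Set where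
    or-decidable′      : ∀ o → SΔ (decidable′ (atom (Choose1 o)))
    select-total′      : ∀ o → SΔ (total′ (atom (SelC o)))
    select-functional′ : ∀ o → SΔ (functional′ (atom (SelC o)))
    new-decidable′     : ∀ o → SΔ (decidable′ (Domain′ (atom (Create o))))
    new-functional′    : ∀ o → SΔ (functional′ (atom (Create o)))
    new-injective′     : ∀ o → SΔ (injective′ (atom (Create o)))
    new-disjoint′      : ∀ o o′ → o ≢ o′ → SΔ (disjoint′ (atom (Create o)) (atom (Create o′)))
    initial′           : SΔ (complement′ (atom 𝒮) (newOccs Δ) (λ o → atom (Create o)))

  record IsSelectionStructure (M : Structure (SelVocab Δ) D) : Set where
    field
      or-decidable      : ∀ o → Decidable (rel M (Choose1 o))
      select-total      : ∀ o → IsTotal (rel M (SelC o))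
      select-functional : ∀ o → IsFunctional (rel M (SelC o))
      new-decidable     : ∀ o → Decidable (Domain (rel M (Create o)))
      new-functional    : ∀ o → IsFunctional (rel M (Create o))
      new-injective     : ∀ o → IsInjective (rel M (Create o))
      new-disjoint      : ∀ o o′ → o ≢ o′ → AreDisjoint (rel M (Create o)) (rel M (Create o′))
      initial           : ∀ y → rel M 𝒮 (y ∷ []) ⇔ (¬ (Σ[ o ∈ NewOcc Δ ] Image (rel M (Create o)) y))

  model⇔selection-structure : (M : Structure (SelVocab Δ) D) → IsModel M SΔ ⇔ IsSelectionStructure M
  model⇔selection-structure M = mk⇔ model⇒ ⇒model
    where
    atomic : ∀ P → Expresses M (atom P) (rel M P)
    atomic = atom-expresses M

    model⇒ : IsModel M SΔ → IsSelectionStructure M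
    model⇒ ⊨SΔ = record
      { or-decidable      = λ o → to (⊨decidable′ (atomic _)) (⊨SΔ _ (or-decidable′ o))
      ; select-total      = λ o → to (⊨total′ (atomic _)) (⊨SΔ _ (select-total′ o))
      ; select-functional = λ o → to (⊨functional′ (atomic _)) (⊨SΔ _ (select-functional′ o))
      ; new-decidable     = λ o → to (⊨decidable′ (Domain′-expresses (atomic _))) (⊨SΔ _ (new-decidable′ o))
      ; new-functional    = λ o → to (⊨functional′ (atomic _)) (⊨SΔ _ (new-functional′ o))
      ; new-injective     = λ o → to (⊨injective′ (atomic _)) (⊨SΔ _ (new-injective′ o))
      ; new-disjoint      = λ o o′ o≢o′ →
                              to (⊨disjoint′ (atomic _) (atomic _)) (⊨SΔ _ (new-disjoint′ o o′ o≢o′))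
      ; initial           =
          to (⊨complement′ (newOccs-enumerates Δ) (atomic _) (λ _ → atomic _)) (⊨SΔ _ initial′)
      }

    module _ (s : IsSelectionStructure M) where
      open IsSelectionStructure s

      ⇒model : IsModel M SΔ
      ⇒model _ (or-decidable′ o)         = from (⊨decidable′ (atomic _)) (or-decidable o)
      ⇒model _ (select-total′ o)         = from (⊨total′ (atomic _)) (select-total o)
      ⇒model _ (select-functional′ o)    = from (⊨functional′ (atomic _)) (select-functional o)
      ⇒model _ (new-decidable′ o)        = from (⊨decidable′ (Domain′-expresses (atomic _))) (new-decidable o)
      ⇒model _ (new-functional′ o)       = from (⊨functional′ (atomic _)) (new-functional o)
      ⇒model _ (new-injective′ o)        = from (⊨injective′ (atomic _)) (new-injective o)
      ⇒model _ (new-disjoint′ o o′ o≢o′) = from (⊨disjoint′ (atomic _) (atomic _)) (new-disjoint o o′ o≢o′)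
      ⇒model _ initial′                  =
        from (⊨complement′ (newOccs-enumerates Δ) (atomic _) (λ _ → atomic _)) initial

  oneIf : {A : Set} → Dec A → OneTwo Δ
  oneIf (yes _) = one
  oneIf (no _)  = two

  oneIf≡one : {A : Set} (A? : Dec A) → oneIf A? ≡ one ⇔ A
  oneIf≡one (yes a) = mk⇔ (λ _ → a) (λ _ → refl)
  oneIf≡one (no ¬a) = mk⇔ (λ ()) (⊥-elim ∘ ¬a)

  _≟one : (t : OneTwo Δ) → Dec (t ≡ one)
  one ≟one = yes refl
  two ≟one = no λ ()

  ≡-by-one : {a b : OneTwo Δ} → (a ≡ one ⇔ b ≡ one) → a ≡ b
  ≡-by-one {one}       a⇔b = sym (to a⇔b refl)
  ≡-by-one {two} {one} a⇔b = from a⇔b refl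
  ≡-by-one {two} {two} _   = refl

  not-created⇔ζin : (ζ : SelFun Δ D) (M : Structure (SelVocab Δ) D) →
                    (∀ o xs y → rel M (Create o) (xs ∷ʳ y) ⇔ (newF ζ o xs ≡ just y)) →
                    ∀ y → (¬ (Σ[ o ∈ NewOcc Δ ] Image (rel M (Create o)) y)) ⇔ ζin Δ ζ y
  not-created⇔ζin ζ M Create⇔newF y = ¬-cong-⇔ (mk⇔
    (λ (o , xs , r) → o , xs , to   (Create⇔newF o xs y) r)
    (λ (o , xs , e) → o , xs , from (Create⇔newF o xs y) e))

  corresponds⇒selection-structure : {ζ : SelFun Δ D} {M : Structure (SelVocab Δ) D} →
                                    Corresponds Δ ζ M → IsSelectionStructure M
  corresponds⇒selection-structure {ζ = ζ} {M} c = record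
    { or-decidable      = λ o xs → Dec.map (⇔-sym (Choose1↔ o xs)) (orF ζ o xs ≟one)
    ; select-total      = λ o xs → selF ζ o xs , from (Sel↔graph o xs _) refl
    ; select-functional = λ o r r′ → trans (sym (sel o r)) (sel o r′)
    ; new-decidable     = λ o xs → Dec.map (mk⇔ (λ (y , e) → y , from (Create↔graph o xs y) e)
                                                (λ (y , r) → y , new o r))
                                           (just? (newF ζ o xs))
    ; new-functional    = λ o r r′ → just-injective (trans (sym (new o r)) (new o r′))
    ; new-injective     = λ o r r′ → newF-injective ζ o _ _ _ (new o r) (new o r′)
    ; new-disjoint      = λ o o′ o≢o′ (xs , r) (xs′ , r′) →
                            newF-disjoint ζ o o′ o≢o′ xs xs′ _ (new o r) (new o′ r′)
    ; initial           = λ y → ⇔-sym (not-created⇔ζin ζ M Create↔graph y) ⇔-∘ S↔ζin y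
    }
    where
    open Corresponds c

    sel : ∀ o {xs y} → rel M (SelC o) (xs ∷ʳ y) → selF ζ o xs ≡ y
    sel o = to (Sel↔graph o _ _)

    new : ∀ o {xs y} → rel M (Create o) (xs ∷ʳ y) → newF ζ o xs ≡ just y
    new o = to (Create↔graph o _ _)

  module _ {M : Structure (SelVocab Δ) D} (s : IsSelectionStructure M) where
    open IsSelectionStructure s

    newFOf : (o : NewOcc Δ) → Vec D (proj₁ o) → Maybe D
    newFOf o = partial {R = rel M (Create o)} (new-decidable o)

    newFOf-graph : ∀ o xs y → rel M (Create o) (xs ∷ʳ y) ⇔ (newFOf o xs ≡ just y)
    newFOf-graph o xs y = ⇔-sym (partial-graph (new-functional o) (new-decidable o) xs y)

    selFunOf : SelFun Δ D
    selFunOf = record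
      { orF            = λ o xs → oneIf (or-decidable o xs)
      ; selF           = λ o xs → proj₁ (select-total o xs)
      ; newF           = newFOf
      ; newF-injective = λ o xs xs′ y e e′ →
                           new-injective o (from (newFOf-graph o xs y) e) (from (newFOf-graph o xs′ y) e′)
      ; newF-disjoint  = λ o o′ o≢o′ xs xs′ y e e′ →
                           new-disjoint o o′ o≢o′ (xs  , from (newFOf-graph o  xs  y) e)
                                                  (xs′ , from (newFOf-graph o′ xs′ y) e′)
      }

    selFunOf-corresponds : Corresponds Δ selFunOf M
    selFunOf-corresponds = record
      { S↔ζin        = λ y → not-created⇔ζin selFunOf M newFOf-graph y ⇔-∘ initial y
      ; Choose1↔     = λ o xs → ⇔-sym (oneIf≡one (or-decidable o xs))
      ; Sel↔graph    = λ o xs y →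
                         ⇔-sym (total-graph {R = rel M (SelC o)} (select-functional o) (select-total o) xs y)
      ; Create↔graph = newFOf-graph
      }

  selRel : SelFun Δ D → (P : SelSym Δ) → Vec D (selArity Δ P) → Set
  selRel ζ 𝒮           v  = ζin Δ ζ (head v)
  selRel ζ (Choose1 o) xs = orF ζ o xs ≡ one
  selRel ζ (SelC o)       = uncurryʳ (λ xs y → selF ζ o xs ≡ y)
  selRel ζ (Create o)     = uncurryʳ (λ xs y → newF ζ o xs ≡ just y)

  structureOf : SelFun Δ D → Structure (SelVocab Δ) D
  structureOf ζ = record { rel = selRel ζ }

  structureOf-corresponds : (ζ : SelFun Δ D) → Corresponds Δ ζ (structureOf ζ)
  structureOf-corresponds ζ = record
    { S↔ζin        = λ d → ⇔-id _
    ; Choose1↔     = λ o xs → ⇔-id _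
    ; Sel↔graph    = λ o → uncurryʳ-∷ʳ _
    ; Create↔graph = λ o → uncurryʳ-∷ʳ _
    }

  corresponds⇒≈structureOf : {ζ : SelFun Δ D} {M : Structure (SelVocab Δ) D} →
                             Corresponds Δ ζ M → SameStructure Δ M (structureOf ζ)
  corresponds⇒≈structureOf c = λ
    { 𝒮 (d ∷ [])       → S↔ζin d
    ; (Choose1 o) xs  → Choose1↔ o xs
    ; (SelC o)        → ⇔-uncurryʳ _ (Sel↔graph o)
    ; (Create o)      → ⇔-uncurryʳ _ (Create↔graph o)
    }
    where open Corresponds c

  corresponds-unique-structure : {ζ : SelFun Δ D} {M M′ : Structure (SelVocab Δ) D} →
                                 Corresponds Δ ζ M → Corresponds Δ ζ M′ → SameStructure Δ M M′
  corresponds-unique-structure c c′ P v =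
    ⇔-sym (corresponds⇒≈structureOf c′ P v) ⇔-∘ corresponds⇒≈structureOf c P v

  corresponds-unique-selFun : {ζ ζ′ : SelFun Δ D} {M : Structure (SelVocab Δ) D} →
                              Corresponds Δ ζ M → Corresponds Δ ζ′ M → SameSelFun Δ ζ ζ′
  corresponds-unique-selFun c c′ =
      (λ o xs → ≡-by-one (C′.Choose1↔ o xs ⇔-∘ ⇔-sym (C.Choose1↔ o xs)))
    , (λ o xs → to (C.Sel↔graph o xs _) (from (C′.Sel↔graph o xs _) refl))
    , (λ o xs → ≡-by-just (λ y → C′.Create↔graph o xs y ⇔-∘ ⇔-sym (C.Create↔graph o xs y)))
    where
    module C  = Corresponds c
    module C′ = Corresponds c′

lemma4 : (V : Vocabulary) (Δ : CLogTheory V) →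
         Σ[ S ∈ FOTheory (SelVocab Δ) ] OneToOneCorrespondence Δ S
lemma4 V Δ = SΔ , λ D →
    (λ ζ → structureOf ζ
         , from (model⇔selection-structure _) (corresponds⇒selection-structure (structureOf-corresponds ζ))
         , structureOf-corresponds ζ)
  , (λ M ⊨SΔ → let s = to (model⇔selection-structure M) ⊨SΔ in selFunOf s , selFunOf-corresponds s)
  , (λ _ _ _ → corresponds-unique-selFun)
  , (λ _ _ _ → corresponds-unique-structure)
  where open SelectionTheory Δ
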